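{- For every graph $G$ on vertex set $V=\{1,2,\dots,n\}$, there exists a unit interval graph $\widehat{G}$ on vertex set $V$ such that \[ \frac{ed(G,\widehat{G})}{n^2}\le 26\,\Gamma_1(G)^{1/3}. \]
   Context: For a graph $G$ on vertex set $\{1,\dots,n\}$, the augmented adjacency matrix $B_G$ is the adjacency matrix of $G$ with all diagonal entries replaced by $1$. For $x\in\mathbb{R}$ let $[x]_+=\max(x,0)$. For a symmetric $n\times n$ matrix $A$, \[ \Gamma_1(A)=\frac{1}{n^3}\sum_{1\le i<k<j\le n}\Big([A_{i,j}-A_{i,k}]_+ + [A_{i,j}-A_{k,j}]_+\Big), \] and $\Gamma_1(G):=\Gamma_1(B_G)$. For two graphs $G,\widehat G$ on the same labelled vertex set, the edit distance $ed(G,\widehat G)$ is the minimum number of edge deletions and edge additions needed to transform $G$ into $\widehat G$ (i.e. the size of the symmetric difference of their edge sets). A unit interval graph is an intersection graph of a family of unit-length intervals of the real line; equivalently, a graph for which there exists a linear ordering of its vertices such that the augmented adjacency matrix, with rows and columns in that order, is a Robinson matrix (a symmetric matrix $M$ with $M_{i,j}\ge M_{i,k}$ and $M_{j,k}\ge M_{i,k}$ for all $i<j<k$). -}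

module Defs where

open import Data.Nat using (ℕ; zero; suc; _+_; _*_; _∸_; _^_; _≤_)
open import Data.Bool using (Bool; true; false; if_then_else_; _∧_; _xor_)
open import Data.Fin using (Fin; _<_; _<?_)
open import Data.Fin.Permutation using (Permutation′; _⟨$⟩ʳ_)
open import Data.List using (List; map; allFin)
open import Data.Nat.ListAction using (sum)
open import Relation.Nullary.Decidable using (⌊_⌋)
open import Relation.Binary.PropositionalEquality using (_≡_)

-- Finite simple graph on vertex set Fin n (standing for {1,…,n}).
record Graph (n : ℕ) : Set where
  field
    adj   : Fin n → Fin n → Bool
    sym   : ∀ i j → adj i j ≡ adj j i
    irrefl : ∀ i → adj i i ≡ false
open Graph public

Σ[_] : (n : ℕ) → (Fin n → ℕ) → ℕ
Σ[ n ] f = sum (map f (allFin n))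

[_]? : Bool → ℕ
[ true ]? = 1
[ false ]? = 0

B : ∀ {n} → Graph n → Fin n → Fin n → ℕ
B G i j with ⌊ i Data.Fin.≟ j ⌋
... | true  = 1
... | false = [ adj G i j ]?

-- n^3 · Γ₁(A) for a ℕ-valued matrix A. For ℕ, x ∸ y = [x - y]_+.
Γ₁num : ∀ {n} → (Fin n → Fin n → ℕ) → ℕ
Γ₁num {n} A =
  Σ[ n ] λ i → Σ[ n ] λ k → Σ[ n ] λ j →
    if ⌊ i <? k ⌋ ∧ ⌊ k <? j ⌋
    then (A i j ∸ A i k) + (A i j ∸ A k j)
    else 0

Γ₁Gnum : ∀ {n} → Graph n → ℕ
Γ₁Gnum G = Γ₁num (B G)

ed : ∀ {n} → Graph n → Graph n → ℕ
ed {n} G H = Σ[ n ] λ i → Σ[ n ] λ j →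
  if ⌊ i <? j ⌋ then [ adj G i j xor adj H i j ]? else 0

IsRobinson : ∀ {n} → (Fin n → Fin n → ℕ) → Set
IsRobinson {n} M = ∀ (i j k : Fin n) → i < j → j < k →
  (M i k ≤ M i j) Data.Product.× (M i k ≤ M j k)
  where import Data.Product

-- Unit interval graph: some linear ordering of the vertices (a permutation σ,
-- position p ↦ vertex σ p) makes the reordered augmented adjacency matrix Robinson.
IsUnitInterval : ∀ {n} → Graph n → Set
IsUnitInterval {n} G = Data.Product.Σ (Permutation′ n) λ σ →
  IsRobinson (λ p q → B G (σ ⟨$⟩ʳ p) (σ ⟨$⟩ʳ q))
  where import Data.Product

module Submission where

open import Defs
open import Data.Nat using (ℕ; _*_; _^_; _≤_)
open import Data.Product using (Σ; _×_)

-- Let E be the upper triangle of the adjacency matrix, indexed by ℕ.  Sort E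
-- in two steps: rearrange every row x into R, whose ones sit right after the
-- diagonal, then every column y of R into C, whose ones sit right above it.
-- The ones of C spread monotonically away from the diagonal, so C is the upper
-- triangle of a Robinson matrix and defines a unit interval graph Ĝ.  The cost
-- is controlled by a sorting lemma: making m mismatches inside a 0/1 sequence
-- forces m²/4 inversions, and inversions are violations of the Robinson
-- property counted by Γ₁.  Summing over rows and columns with Cauchy–Schwarz
-- (row sorting creates no new column violations) gives ed² ≤ 8n · n³Γ₁, and
-- together with ed ≤ n² this yields ed³ ≤ 8 · n³Γ₁ · n³.

open import Data.Nat using (zero; suc; _+_; _∸_; _⊓_; _<_; z≤n; s≤s; s≤s⁻¹; _<?_; _≤?_)
open import Data.Nat.Properties
open import Data.Nat.Tactic.RingSolver using (solve-∀)
open import Algebra.Properties.CommutativeSemigroup +-commutativeSemigroup using () renaming (interchange to +-interchange)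
open import Data.Nat.ListAction using (sum)
open import Data.Bool using (Bool; true; false; _∧_; _xor_; not; if_then_else_; T)
open import Data.Bool.Properties using (T-∧; ∧-zeroʳ; ∧-assoc; ∧-comm)
open import Data.Unit using (tt)
open import Data.Empty using (⊥; ⊥-elim)
open import Data.Sum using (_⊎_; inj₁; inj₂; [_,_]′)
open import Data.Product using (_,_; proj₁; proj₂)
open import Data.Fin using (Fin; toℕ; fromℕ<)
import Data.Fin as Fin
open import Data.Fin.Properties using (fromℕ<-toℕ; toℕ<n)
import Data.Fin.Permutation as Permutation
open import Data.List using (tabulate)
open import Data.List.Properties using (map-tabulate)
open import Function using (_∘_; id)
open import Function.Bundles using (Equivalence)
open import Relation.Nullary using (Dec; yes; no)
open import Relation.Nullary.Decidable using (⌊_⌋; toWitness; fromWitness; toWitnessFalse; fromWitnessFalse)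
open import Relation.Binary.PropositionalEquality renaming (sym to ≡-sym)

∑ : ℕ → (ℕ → ℕ) → ℕ
∑ zero    f = 0
∑ (suc n) f = ∑ n f + f n

infixr 8 ∑
syntax ∑ n (λ x → e) = ∑[ x < n ] e

∑-cong : ∀ n {f g : ℕ → ℕ} → (∀ x → x < n → f x ≡ g x) → ∑ n f ≡ ∑ n g
∑-cong zero    h = refl
∑-cong (suc n) h = cong₂ _+_ (∑-cong n (λ x x<n → h x (m<n⇒m<1+n x<n))) (h n ≤-refl)

∑-mono-≤ : ∀ n {f g : ℕ → ℕ} → (∀ x → x < n → f x ≤ g x) → ∑ n f ≤ ∑ n g
∑-mono-≤ zero    h = z≤n
∑-mono-≤ (suc n) h = +-mono-≤ (∑-mono-≤ n (λ x x<n → h x (m<n⇒m<1+n x<n))) (h n ≤-refl)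

∑-distrib-+ : ∀ n (f g : ℕ → ℕ) → ∑[ x < n ] (f x + g x) ≡ ∑ n f + ∑ n g
∑-distrib-+ zero    f g = refl
∑-distrib-+ (suc n) f g = begin
  ∑[ x < n ] (f x + g x) + (f n + g n)  ≡⟨ cong (_+ (f n + g n)) (∑-distrib-+ n f g) ⟩
  (∑ n f + ∑ n g) + (f n + g n)         ≡⟨ +-interchange (∑ n f) (∑ n g) (f n) (g n) ⟩
  (∑ n f + f n) + (∑ n g + g n)         ∎
  where open ≡-Reasoning

∑-scale : ∀ n c (f : ℕ → ℕ) → ∑[ x < n ] (c * f x) ≡ c * ∑ n f
∑-scale zero    c f = ≡-sym (*-zeroʳ c)
∑-scale (suc n) c f =
  trans (cong (_+ c * f n) (∑-scale n c f)) (≡-sym (*-distribˡ-+ c (∑ n f) (f n)))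

∑-const : ∀ n c → ∑[ _ < n ] c ≡ n * c
∑-const zero    c = refl
∑-const (suc n) c = trans (cong (_+ c) (∑-const n c)) (+-comm (n * c) c)

+-∸-subadditive : ∀ a b c d → (a + b) ∸ (c + d) ≤ (a ∸ c) + (b ∸ d)
+-∸-subadditive a b c d = m≤n+o⇒m∸n≤o (a + b) (c + d) (begin
  a + b                               ≤⟨ +-mono-≤ (m≤n+m∸n a c) (m≤n+m∸n b d) ⟩
  (c + (a ∸ c)) + (d + (b ∸ d))       ≡⟨ +-interchange c (a ∸ c) d (b ∸ d) ⟩
  (c + d) + ((a ∸ c) + (b ∸ d))       ∎)
  where open ≤-Reasoning

∑-∸ : ∀ n (f g : ℕ → ℕ) → ∑ n f ∸ ∑ n g ≤ ∑[ x < n ] (f x ∸ g x)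
∑-∸ zero    f g = z≤n
∑-∸ (suc n) f g = ≤-trans (+-∸-subadditive (∑ n f) (f n) (∑ n g) (g n))
                          (+-monoˡ-≤ (f n ∸ g n) (∑-∸ n f g))

∑-comm : ∀ n m (F : ℕ → ℕ → ℕ) → ∑[ x < n ] ∑[ y < m ] F x y ≡ ∑[ y < m ] ∑[ x < n ] F x y
∑-comm zero    m F = ≡-sym (trans (∑-const m 0) (*-zeroʳ m))
∑-comm (suc n) m F = begin
  ∑[ x < n ] ∑[ y < m ] F x y + ∑[ y < m ] F n y   ≡⟨ cong (_+ ∑[ y < m ] F n y) (∑-comm n m F) ⟩
  ∑[ y < m ] ∑[ x < n ] F x y + ∑[ y < m ] F n y   ≡⟨ ≡-sym (∑-distrib-+ m _ (F n)) ⟩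
  ∑[ y < m ] (∑[ x < n ] F x y + F n y)            ∎
  where open ≡-Reasoning

∑-product : ∀ n m (f g : ℕ → ℕ) → ∑ n f * ∑ m g ≡ ∑[ x < n ] ∑[ y < m ] (f x * g y)
∑-product zero    m f g = refl
∑-product (suc n) m f g = begin
  (∑ n f + f n) * ∑ m g                                    ≡⟨ *-distribʳ-+ (∑ m g) (∑ n f) (f n) ⟩
  ∑ n f * ∑ m g + f n * ∑ m g                              ≡⟨ cong₂ _+_ (∑-product n m f g) (≡-sym (∑-scale m (f n) g)) ⟩
  ∑[ x < n ] ∑[ y < m ] (f x * g y) + ∑[ y < m ] (f n * g y) ∎
  where open ≡-Reasoning

2xy≤x²+y² : ∀ x y → 2 * (x * y) ≤ x * x + y * y
2xy≤x²+y² x y = [ ordered , flipped ]′ (≤-total x y)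
  where
  ordered : ∀ {x y} → x ≤ y → 2 * (x * y) ≤ x * x + y * y
  ordered {x} x≤y with d , refl ← m≤n⇒∃[o]m+o≡n x≤y =
    ≤-trans (m≤m+n _ (d * d)) (≤-reflexive (expand x d))
    where
    expand : ∀ x d → 2 * (x * (x + d)) + d * d ≡ x * x + (x + d) * (x + d)
    expand = solve-∀
  flipped : y ≤ x → 2 * (x * y) ≤ x * x + y * y
  flipped y≤x = subst₂ _≤_ (cong (2 *_) (*-comm y x)) (+-comm (y * y) (x * x)) (ordered y≤x)

cauchy-schwarz : ∀ n (f : ℕ → ℕ) → ∑ n f * ∑ n f ≤ n * ∑[ x < n ] (f x * f x)
cauchy-schwarz zero    f = z≤n
cauchy-schwarz (suc n) f = begin
  (A + b) * (A + b)                  ≡⟨ square A b ⟩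
  A * A + 2 * (A * b) + b * b        ≤⟨ +-monoˡ-≤ (b * b) (+-mono-≤ (cauchy-schwarz n f) cross) ⟩
  n * Q + (Q + n * (b * b)) + b * b  ≡⟨ regroup n Q (b * b) ⟩
  suc n * (Q + b * b)                ∎
  where
  open ≤-Reasoning
  A b Q : ℕ
  A = ∑ n f
  b = f n
  Q = ∑[ x < n ] (f x * f x)
  square : ∀ A b → (A + b) * (A + b) ≡ A * A + 2 * (A * b) + b * b
  square = solve-∀
  regroup : ∀ n Q c → n * Q + (Q + n * c) + c ≡ (1 + n) * (Q + c)
  regroup = solve-∀
  -- The cross term is absorbed termwise by AM–GM: 2 b f x ≤ b² + f x².
  cross : 2 * (A * b) ≤ Q + n * (b * b)
  cross = begin
    2 * (A * b)                          ≡⟨ cong (2 *_) (trans (*-comm A b) (≡-sym (∑-scale n b f))) ⟩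
    2 * ∑[ x < n ] (b * f x)             ≡⟨ ≡-sym (∑-scale n 2 (λ x → b * f x)) ⟩
    ∑[ x < n ] (2 * (b * f x))           ≤⟨ ∑-mono-≤ n (λ x _ → 2xy≤x²+y² b (f x)) ⟩
    ∑[ x < n ] (b * b + f x * f x)       ≡⟨ ∑-distrib-+ n (λ _ → b * b) (λ x → f x * f x) ⟩
    ∑[ _ < n ] (b * b) + Q               ≡⟨ cong (_+ Q) (∑-const n (b * b)) ⟩
    n * (b * b) + Q                      ≡⟨ +-comm (n * (b * b)) Q ⟩
    Q + n * (b * b)                      ∎

∑-square-bound : ∀ n (f g : ℕ → ℕ) → (∀ x → x < n → f x * f x ≤ 4 * g x) →
                 ∑ n f * ∑ n f ≤ n * (4 * ∑ n g)
∑-square-bound n f g bound = ≤-trans (cauchy-schwarz n f)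
  (*-monoʳ-≤ n (≤-trans (∑-mono-≤ n bound) (≤-reflexive (∑-scale n 4 g))))

square-of-sum≤ : ∀ X Y → (X + Y) * (X + Y) ≤ 2 * (X * X + Y * Y)
square-of-sum≤ X Y = begin
  (X + Y) * (X + Y)                ≡⟨ expand X Y ⟩
  X * X + Y * Y + 2 * (X * Y)      ≤⟨ +-monoʳ-≤ (X * X + Y * Y) (2xy≤x²+y² X Y) ⟩
  X * X + Y * Y + (X * X + Y * Y)  ≡⟨ double (X * X + Y * Y) ⟩
  2 * (X * X + Y * Y)              ∎
  where
  open ≤-Reasoning
  expand : ∀ X Y → (X + Y) * (X + Y) ≡ X * X + Y * Y + 2 * (X * Y)
  expand = solve-∀
  double : ∀ s → s + s ≡ 2 * s
  double = solve-∀

cube-bound : ∀ n {D} X Y I J → D ≤ X + Y → X * X ≤ n * (4 * I) → Y * Y ≤ n * (4 * J) →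
             D ≤ n * n → D ^ 3 ≤ 8 * (I + J) * n ^ 3
cube-bound n {D} X Y I J D≤X+Y X²≤ Y²≤ D≤n² = begin
  D ^ 3                          ≡⟨ cong (λ t → D * (D * t)) (*-identityʳ D) ⟩
  D * (D * D)                    ≤⟨ *-mono-≤ D≤n² D²≤ ⟩
  (n * n) * (8 * (n * (I + J)))  ≡⟨ regroup n (I + J) ⟩
  8 * (I + J) * n ^ 3            ∎
  where
  open ≤-Reasoning
  regroup : ∀ n s → (n * n) * (8 * (n * s)) ≡ 8 * s * (n * (n * (n * 1)))
  regroup = solve-∀
  collect : ∀ n I J → 2 * (n * (4 * I) + n * (4 * J)) ≡ 8 * (n * (I + J))
  collect = solve-∀
  D²≤ : D * D ≤ 8 * (n * (I + J))
  D²≤ = begin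
    D * D                            ≤⟨ *-mono-≤ D≤X+Y D≤X+Y ⟩
    (X + Y) * (X + Y)                ≤⟨ square-of-sum≤ X Y ⟩
    2 * (X * X + Y * Y)              ≤⟨ *-monoʳ-≤ 2 (+-mono-≤ X²≤ Y²≤) ⟩
    2 * (n * (4 * I) + n * (4 * J))  ≡⟨ collect n I J ⟩
    8 * (n * (I + J))                ∎

χ : Bool → ℕ
χ = [_]?

lt le : ℕ → ℕ → Bool
lt x y = ⌊ x <? y ⌋
le x y = ⌊ x ≤? y ⌋

-- Working with tests T a.  The first conjunct is passed explicitly because
-- _∧_ does not determine its arguments during unification.
∧-elim : ∀ a {b} → T (a ∧ b) → T a × T b
∧-elim a = Equivalence.to T-∧

∧-intro : ∀ a {b} → T a → T b → T (a ∧ b)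
∧-intro a p q = Equivalence.from T-∧ (p , q)

χ≤1 : ∀ a → χ a ≤ 1
χ≤1 true  = ≤-refl
χ≤1 false = z≤n

χ-true : ∀ {a} → T a → 1 ≤ χ a
χ-true {true} _ = ≤-refl

χ-mono : ∀ a b → (T a → T b) → χ a ≤ χ b
χ-mono false b       _ = z≤n
χ-mono true  true    _ = ≤-refl
χ-mono true  false   h = ⊥-elim (h tt)

χ-cover : ∀ a b c → (T a → T b ⊎ T c) → χ a ≤ χ b + χ c
χ-cover false b c _ = z≤n
χ-cover true  b c h with h tt
... | inj₁ tb = ≤-trans (χ-true tb) (m≤m+n (χ b) (χ c))
... | inj₂ tc = ≤-trans (χ-true tc) (m≤n+m (χ c) (χ b))

χ-split : ∀ a b → χ a ≡ χ (a ∧ b) + χ (a ∧ not b)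
χ-split false b     = refl
χ-split true  true  = refl
χ-split true  false = refl

χ-cong : ∀ a b → (T a → T b) → (T b → T a) → χ a ≡ χ b
χ-cong a b a⇒b b⇒a = ≤-antisym (χ-mono a b a⇒b) (χ-mono b a b⇒a)

∧∧-elim : ∀ a b {c} → T ((a ∧ b) ∧ c) → T a × T b × T c
∧∧-elim a b abc with ab , c ← ∧-elim (a ∧ b) abc = proj₁ (∧-elim a ab) , proj₂ (∧-elim a ab) , c

∑-interval : ∀ n L H → ∑[ y < n ] χ (le L y ∧ lt y H) ≡ (n ⊓ H) ∸ L
∑-interval zero    L H = ≡-sym (0∸n≡0 L)
∑-interval (suc n) L H with L ≤? n | n <? H
... | yes L≤n | yes n<H
  rewrite ∑-interval n L H | m≤n⇒m⊓n≡m (<⇒≤ n<H) | m≤n⇒m⊓n≡m n<H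
  = trans (+-comm (n ∸ L) 1) (≡-sym (+-∸-assoc 1 L≤n))
... | no L≰n  | yes _
  rewrite ∑-interval n L H
  | m≤n⇒m∸n≡0 (≤-trans (m⊓n≤m n H) (<⇒≤ (≰⇒> L≰n)))
  | m≤n⇒m∸n≡0 (≤-trans (m⊓n≤m (suc n) H) (≰⇒> L≰n))
  = refl
... | _       | no n≮H
  rewrite ∑-interval n L H | m≥n⇒m⊓n≡n (≮⇒≥ n≮H) | m≥n⇒m⊓n≡n (m≤n⇒m≤1+n (≮⇒≥ n≮H))
  = trans (cong (λ b → H ∸ L + χ b) (∧-zeroʳ _)) (+-identityʳ (H ∸ L))

mismatch : ℕ → (w b t : ℕ → Bool) → ℕ
mismatch n w b t = ∑[ x < n ] χ (w x ∧ (b x xor t x))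

-- Let t have, inside the window w, as many ones as b.  Then the
-- Z positions where t = 1 ≠ b ("missing" ones) are exactly as many as the O
-- positions where b = 1 ≠ t ("surplus" ones), so the squared mismatch
-- (Z + O)² is 4 · Z · O, four times the number of (missing, surplus) pairs.  If
-- each such pair has weight at least 1 under I, it is at most 4 · ∑∑ I.
sorting-bound : ∀ n (w b t : ℕ → Bool) (I : ℕ → ℕ → ℕ) →
  ∑[ x < n ] χ (w x ∧ b x) ≡ ∑[ x < n ] χ (w x ∧ t x) →
  (∀ u v → T ((w u ∧ t u) ∧ not (b u)) → T ((w v ∧ b v) ∧ not (t v)) → 1 ≤ I u v) →
  mismatch n w b t * mismatch n w b t ≤ 4 * ∑[ u < n ] ∑[ v < n ] I u v
sorting-bound n w b t I same-count pair-weight = begin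
  mismatch n w b t * mismatch n w b t      ≡⟨ cong (λ m → m * m) mismatch-split ⟩
  (Z + O) * (Z + O)                        ≡⟨ square-of-equal Z O balanced ⟩
  4 * (Z * O)                              ≡⟨ cong (4 *_) (∑-product n n (χ ∘ missing) (χ ∘ surplus)) ⟩
  4 * ∑[ u < n ] ∑[ v < n ] (χ (missing u) * χ (surplus v))
    ≤⟨ *-monoʳ-≤ 4 (∑-mono-≤ n λ u _ → ∑-mono-≤ n λ v _ → χ*χ≤ (pair-weight u v)) ⟩
  4 * ∑[ u < n ] ∑[ v < n ] I u v          ∎
  where
  open ≤-Reasoning
  missing surplus : ℕ → Bool
  missing x = (w x ∧ t x) ∧ not (b x)
  surplus x = (w x ∧ b x) ∧ not (t x)
  Z O : ℕ
  Z = ∑ n (χ ∘ missing)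
  O = ∑ n (χ ∘ surplus)

  mismatch-split : mismatch n w b t ≡ Z + O
  mismatch-split = trans (∑-cong n λ x _ → pointwise (w x) (b x) (t x)) (∑-distrib-+ n _ _)
    where
    pointwise : ∀ w b t → χ (w ∧ (b xor t)) ≡ χ ((w ∧ t) ∧ not b) + χ ((w ∧ b) ∧ not t)
    pointwise false b     t     = refl
    pointwise true  true  true  = refl
    pointwise true  true  false = refl
    pointwise true  false true  = refl
    pointwise true  false false = refl

  -- Both counts equal (ones common to b and t) + Z, resp. + O.
  balanced : Z ≡ O
  balanced = +-cancelˡ-≡ common Z O (begin-equality
    common + Z                       ≡⟨ ≡-sym (∑-distrib-+ n _ _) ⟩
    ∑[ x < n ] (χ ((w x ∧ t x) ∧ b x) + χ (missing x))
      ≡⟨ ∑-cong n (λ x _ → ≡-sym (χ-split (w x ∧ t x) (b x))) ⟩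
    ∑[ x < n ] χ (w x ∧ t x)          ≡⟨ ≡-sym same-count ⟩
    ∑[ x < n ] χ (w x ∧ b x)
      ≡⟨ ∑-cong n (λ x _ → trans (χ-split (w x ∧ b x) (t x)) (cong (λ c → χ c + χ (surplus x)) (swap (w x) (b x) (t x)))) ⟩
    ∑[ x < n ] (χ ((w x ∧ t x) ∧ b x) + χ (surplus x))  ≡⟨ ∑-distrib-+ n _ _ ⟩
    common + O                       ∎)
    where
    common : ℕ
    common = ∑[ x < n ] χ ((w x ∧ t x) ∧ b x)
    swap : ∀ w b t → (w ∧ b) ∧ t ≡ (w ∧ t) ∧ b
    swap w b t = trans (∧-assoc w b t) (trans (cong (w ∧_) (∧-comm b t)) (≡-sym (∧-assoc w t b)))

  square-of-equal : ∀ z o → z ≡ o → (z + o) * (z + o) ≡ 4 * (z * o)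
  square-of-equal z .z refl = double z
    where
    double : ∀ z → (z + z) * (z + z) ≡ 4 * (z * z)
    double = solve-∀

  χ*χ≤ : ∀ {a c k} → (T a → T c → 1 ≤ k) → χ a * χ c ≤ k
  χ*χ≤ {false}         _ = z≤n
  χ*χ≤ {true} {false}  _ = z≤n
  χ*χ≤ {true} {true}   h = h tt tt

-- How much an entry far from the diagonal exceeds one nearer to it; for a
-- 0/1 matrix this is the summand [A_far - A_near]₊ of Γ₁.
violation : (far near : Bool) → ℕ
violation far near = χ far ∸ χ near

violation≤χ : ∀ c far near → (if c then violation far near else 0) ≤ χ (far ∧ not near)
violation≤χ false far   near  = z≤n
violation≤χ true  true  true  = z≤n
violation≤χ true  true  false = ≤-refl
violation≤χ true  false near  = ≤-reflexive (0∸n≡0 (χ near))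

violation-window : ∀ {c} d far near → T c →
  (if c ∧ d then violation far near else 0) ≡ χ (d ∧ far) ∸ χ (d ∧ near)
violation-window {true} true  far near _ = refl
violation-window {true} false far near _ = refl

violation-outside : ∀ {c} d far near → T (not c) → (if c ∧ d then violation far near else 0) ≡ 0
violation-outside {false} d far near _ = refl

violation-hit : ∀ {c far near} → T c → T far → T (not near) → 1 ≤ (if c then violation far near else 0)
violation-hit {true} {true} {false} _ _ _ = ≤-refl

rowTerm colTerm : (ℕ → ℕ → Bool) → ℕ → ℕ → ℕ → ℕ
rowTerm M i k j = if lt i k ∧ lt k j then violation (M i j) (M i k) else 0
colTerm M i k j = if lt i k ∧ lt k j then violation (M i j) (M k j) else 0

rowViolations colViolations : ℕ → (ℕ → ℕ → Bool) → ℕ → ℕ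
rowViolations n M i = ∑[ k < n ] ∑[ j < n ] rowTerm M i k j
colViolations n M j = ∑[ i < n ] ∑[ k < n ] colTerm M i k j

robinsonDefect : ℕ → (ℕ → ℕ → Bool) → ℕ
robinsonDefect n M = ∑[ i < n ] ∑[ k < n ] ∑[ j < n ]
  (if lt i k ∧ lt k j then violation (M i j) (M i k) + violation (M i j) (M k j) else 0)

∑-rotate : ∀ n (F : ℕ → ℕ → ℕ → ℕ) →
  ∑[ z < n ] ∑[ x < n ] ∑[ y < n ] F x y z ≡ ∑[ x < n ] ∑[ y < n ] ∑[ z < n ] F x y z
∑-rotate n F = trans (∑-comm n n _) (∑-cong n λ x _ → ∑-comm n n _)

defect-split : ∀ n (M : ℕ → ℕ → Bool) → robinsonDefect n M ≡ ∑ n (rowViolations n M) + ∑ n (colViolations n M)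
defect-split n M = begin
  robinsonDefect n M
    ≡⟨ ∑-cong n (λ i _ → ∑-cong n λ k _ → trans (∑-cong n λ j _ → if-distrib (lt i k ∧ lt k j))
                                                  (∑-distrib-+ n _ _)) ⟩
  ∑[ i < n ] ∑[ k < n ] (∑[ j < n ] rowTerm M i k j + ∑[ j < n ] colTerm M i k j)
    ≡⟨ ∑-cong n (λ i _ → ∑-distrib-+ n _ _) ⟩
  ∑[ i < n ] (rowViolations n M i + ∑[ k < n ] ∑[ j < n ] colTerm M i k j)
    ≡⟨ ∑-distrib-+ n _ _ ⟩
  ∑ n (rowViolations n M) + ∑[ i < n ] ∑[ k < n ] ∑[ j < n ] colTerm M i k j
    ≡⟨ cong (∑ n (rowViolations n M) +_) (≡-sym (∑-rotate n (colTerm M))) ⟩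
  ∑ n (rowViolations n M) + ∑ n (colViolations n M) ∎
  where
  open ≡-Reasoning
  if-distrib : ∀ c {p q} → (if c then p + q else 0) ≡ (if c then p else 0) + (if c then q else 0)
  if-distrib true  = refl
  if-distrib false = refl

upperDistance : ℕ → (M M′ : ℕ → ℕ → Bool) → ℕ
upperDistance n M M′ = ∑[ x < n ] ∑[ y < n ] (if lt x y then χ (M x y xor M′ x y) else 0)

upperDistance≤n² : ∀ n (M M′ : ℕ → ℕ → Bool) → upperDistance n M M′ ≤ n * n
upperDistance≤n² n M M′ = begin
  upperDistance n M M′   ≤⟨ ∑-mono-≤ n (λ x _ → ∑-mono-≤ n λ y _ → at-most-one (lt x y) (M x y xor M′ x y)) ⟩
  ∑[ _ < n ] ∑[ _ < n ] 1  ≡⟨ trans (∑-cong n λ _ _ → ∑-const n 1) (∑-const n (n * 1)) ⟩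
  n * (n * 1)            ≡⟨ cong (n *_) (*-identityʳ n) ⟩
  n * n                  ∎
  where
  open ≤-Reasoning
  at-most-one : ∀ c e → (if c then χ e else 0) ≤ 1
  at-most-one true  e = χ≤1 e
  at-most-one false e = z≤n

upperDistance-triangle : ∀ n (M M′ M″ : ℕ → ℕ → Bool) → upperDistance n M M″ ≤
  ∑[ x < n ] mismatch n (lt x) (M x) (M′ x) + ∑[ y < n ] mismatch n (λ x → lt x y) (λ x → M′ x y) (λ x → M″ x y)
upperDistance-triangle n M M′ M″ = begin
  upperDistance n M M″
    ≤⟨ ∑-mono-≤ n (λ x _ → ∑-mono-≤ n λ y _ → via (lt x y) (M x y) (M′ x y) (M″ x y)) ⟩
  ∑[ x < n ] ∑[ y < n ] (χ (lt x y ∧ (M x y xor M′ x y)) + χ (lt x y ∧ (M′ x y xor M″ x y)))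
    ≡⟨ trans (∑-cong n λ x _ → ∑-distrib-+ n _ _) (∑-distrib-+ n _ _) ⟩
  ∑[ x < n ] mismatch n (lt x) (M x) (M′ x) + ∑[ x < n ] ∑[ y < n ] χ (lt x y ∧ (M′ x y xor M″ x y))
    ≡⟨ cong (_ +_) (∑-comm n n _) ⟩
  ∑[ x < n ] mismatch n (lt x) (M x) (M′ x) + ∑[ y < n ] mismatch n (λ x → lt x y) (λ x → M′ x y) (λ x → M″ x y) ∎
  where
  open ≤-Reasoning
  via : ∀ c e f g → (if c then χ (e xor g) else 0) ≤ χ (c ∧ (e xor f)) + χ (c ∧ (f xor g))
  via false e     f     g     = z≤n
  via true  true  true  true  = z≤n
  via true  true  true  false = ≤-refl
  via true  true  false true  = z≤n
  via true  true  false false = ≤-refl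
  via true  false true  true  = ≤-refl
  via true  false true  false = z≤n
  via true  false false true  = ≤-refl
  via true  false false false = z≤n

module TwoStepSort (n : ℕ) (E : ℕ → ℕ → Bool) where

  rowOnes : ℕ → ℕ
  rowOnes x = ∑[ y < n ] χ (lt x y ∧ E x y)

  R : ℕ → ℕ → Bool
  R x y = le y (x + rowOnes x)

  colOnes : ℕ → ℕ
  colOnes y = ∑[ x < n ] χ (lt x y ∧ R x y)

  C : ℕ → ℕ → Bool
  C x y = le y (x + colOnes y)

  rowOnes-bound : ∀ x → rowOnes x ≤ n ∸ suc x
  rowOnes-bound x = begin
    rowOnes x                                  ≤⟨ ∑-mono-≤ n (λ y y<n → χ-mono _ _ (inside y<n)) ⟩
    ∑[ y < n ] χ (le (suc x) y ∧ lt y n)       ≡⟨ ∑-interval n (suc x) n ⟩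
    (n ⊓ n) ∸ suc x                            ≡⟨ cong (_∸ suc x) (⊓-idem n) ⟩
    n ∸ suc x                                  ∎
    where
    open ≤-Reasoning
    inside : ∀ {y} → y < n → T (lt x y ∧ E x y) → T (le (suc x) y ∧ lt y n)
    inside {y} y<n xy = ∧-intro (le (suc x) y) (proj₁ (∧-elim (lt x y) xy)) (fromWitness y<n)

  R-rowOnes : ∀ {x} → x < n → ∑[ y < n ] χ (lt x y ∧ R x y) ≡ rowOnes x
  R-rowOnes {x} x<n = begin
    ∑[ y < n ] χ (lt x y ∧ R x y)
      ≡⟨ ∑-cong n (λ y _ → χ-cong _ _ (to y) (from y)) ⟩
    ∑[ y < n ] χ (le (suc x) y ∧ lt y (suc (x + a)))   ≡⟨ ∑-interval n (suc x) (suc (x + a)) ⟩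
    (n ⊓ suc (x + a)) ∸ suc x                           ≡⟨ cong (_∸ suc x) (m≥n⇒m⊓n≡n x+a<n) ⟩
    suc (x + a) ∸ suc x                                 ≡⟨ m+n∸m≡n x a ⟩
    a                                                   ∎
    where
    open ≡-Reasoning
    a : ℕ
    a = rowOnes x
    x+a<n : suc (x + a) ≤ n
    x+a<n = subst (_≤ n) (+-comm a (suc x)) (m≤o∸n⇒m+n≤o a x<n (rowOnes-bound x))
    to : ∀ y → T (lt x y ∧ R x y) → T (le (suc x) y ∧ lt y (suc (x + a)))
    to y xy with x<y , Rxy ← ∧-elim (lt x y) xy =
      ∧-intro (le (suc x) y) x<y (fromWitness (s≤s (toWitness Rxy)))
    from : ∀ y → T (le (suc x) y ∧ lt y (suc (x + a))) → T (lt x y ∧ R x y)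
    from y xy with x<y , y≤x+a ← ∧-elim (le (suc x) y) xy =
      ∧-intro (lt x y) x<y (fromWitness (s≤s⁻¹ (toWitness y≤x+a)))

  row-pair : ∀ x k j → T ((lt x k ∧ R x k) ∧ not (E x k)) → T ((lt x j ∧ E x j) ∧ not (R x j)) →
             1 ≤ rowTerm E x k j
  row-pair x k j missing surplus
    with x<k , Rxk , ¬Exk ← ∧∧-elim (lt x k) (R x k) missing
       | _   , Exj , ¬Rxj ← ∧∧-elim (lt x j) (E x j) surplus
    = violation-hit (∧-intro (lt x k) x<k (fromWitness k<j)) Exj ¬Exk
    where
    k<j : k < j
    k<j = ≤-<-trans (toWitness Rxk) (≰⇒> (toWitnessFalse ¬Rxj))

  row-sorting-cost : ∀ {x} → x < n →
    let m = mismatch n (lt x) (E x) (R x) in m * m ≤ 4 * rowViolations n E x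
  row-sorting-cost {x} x<n =
    sorting-bound n (lt x) (E x) (R x) (rowTerm E x) (≡-sym (R-rowOnes x<n)) (row-pair x)

  colOnes-bound : ∀ y → colOnes y ≤ y
  colOnes-bound y = begin
    colOnes y                             ≤⟨ ∑-mono-≤ n (λ x _ → χ-mono _ _ above) ⟩
    ∑[ x < n ] χ (le 0 x ∧ lt x y)        ≡⟨ ∑-interval n 0 y ⟩
    n ⊓ y                                 ≤⟨ m⊓n≤n n y ⟩
    y                                     ∎
    where
    open ≤-Reasoning
    above : ∀ {x} → T (lt x y ∧ R x y) → T (le 0 x ∧ lt x y)
    above {x} xy = ∧-intro (le 0 x) tt (proj₁ (∧-elim (lt x y) xy))

  -- Column sorting keeps the number of ones above the diagonal: C x y holds
  -- above the diagonal exactly for y ∸ colOnes y ≤ x < y.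
  C-colOnes : ∀ {y} → y ≤ n → ∑[ x < n ] χ (lt x y ∧ C x y) ≡ colOnes y
  C-colOnes {y} y≤n = begin
    ∑[ x < n ] χ (lt x y ∧ C x y)            ≡⟨ ∑-cong n (λ x _ → χ-cong _ _ (to x) (from x)) ⟩
    ∑[ x < n ] χ (le (y ∸ c) x ∧ lt x y)    ≡⟨ ∑-interval n (y ∸ c) y ⟩
    (n ⊓ y) ∸ (y ∸ c)                        ≡⟨ cong (_∸ (y ∸ c)) (m≥n⇒m⊓n≡n y≤n) ⟩
    y ∸ (y ∸ c)                              ≡⟨ m∸[m∸n]≡n (colOnes-bound y) ⟩
    c                                        ∎
    where
    open ≡-Reasoning
    c : ℕ
    c = colOnes y
    to : ∀ x → T (lt x y ∧ C x y) → T (le (y ∸ c) x ∧ lt x y)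
    to x xy with x<y , Cxy ← ∧-elim (lt x y) xy =
      ∧-intro (le (y ∸ c) x) (fromWitness (m≤n+o⇒m∸n≤o y c (subst (y ≤_) (+-comm x c) (toWitness Cxy)))) x<y
    from : ∀ x → T (le (y ∸ c) x ∧ lt x y) → T (lt x y ∧ C x y)
    from x xy with y-c≤x , x<y ← ∧-elim (le (y ∸ c) x) xy =
      ∧-intro (lt x y) x<y (fromWitness (≤-trans (m≤n+m∸n y c)
        (≤-trans (+-monoʳ-≤ c (toWitness y-c≤x)) (≤-reflexive (+-comm c x)))))

  col-pair : ∀ y u v → T ((lt u y ∧ C u y) ∧ not (R u y)) → T ((lt v y ∧ R v y) ∧ not (C v y)) →
             1 ≤ colTerm R v u y
  col-pair y u v missing surplus
    with u<y , Cuy , ¬Ruy ← ∧∧-elim (lt u y) (C u y) missing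
       | _   , Rvy , ¬Cvy ← ∧∧-elim (lt v y) (R v y) surplus
    = violation-hit (∧-intro (lt v u) (fromWitness v<u) u<y) Rvy ¬Ruy
    where
    v<u : v < u
    v<u = +-cancelʳ-< (colOnes y) v u (<-≤-trans (≰⇒> (toWitnessFalse ¬Cvy)) (toWitness Cuy))

  col-sorting-cost : ∀ {y} → y ≤ n →
    let m = mismatch n (λ x → lt x y) (λ x → R x y) (λ x → C x y) in m * m ≤ 4 * colViolations n R y
  col-sorting-cost {y} y≤n = begin
    m * m                                      ≤⟨ sorting-bound n (λ x → lt x y) (λ x → R x y) (λ x → C x y)
                                                    (λ u v → colTerm R v u y) (≡-sym (C-colOnes y≤n)) (col-pair y) ⟩
    4 * ∑[ u < n ] ∑[ v < n ] colTerm R v u y  ≡⟨ cong (4 *_) (∑-comm n n (λ u v → colTerm R v u y)) ⟩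
    4 * colViolations n R y                    ∎
    where
    open ≤-Reasoning
    m : ℕ
    m = mismatch n (λ x → lt x y) (λ x → R x y) (λ x → C x y)

  -- Row i has at most k ∸ i ones in the columns i < y ≤ k.
  rowOnes-beyond : ∀ i k → rowOnes i ≤ (k ∸ i) + ∑[ y < n ] χ (lt k y ∧ E i y)
  rowOnes-beyond i k = begin
    rowOnes i                                                 ≤⟨ ∑-mono-≤ n (λ y _ → χ-cover _ _ _ (split y)) ⟩
    ∑[ y < n ] (χ (le (suc i) y ∧ lt y (suc k)) + χ (lt k y ∧ E i y))
                                                              ≡⟨ ∑-distrib-+ n _ _ ⟩
    ∑[ y < n ] χ (le (suc i) y ∧ lt y (suc k)) + F             ≡⟨ cong (_+ F) (∑-interval n (suc i) (suc k)) ⟩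
    (n ⊓ suc k) ∸ suc i + F                                   ≤⟨ +-monoˡ-≤ F (∸-monoˡ-≤ (suc i) (m⊓n≤n n (suc k))) ⟩
    (k ∸ i) + F                                               ∎
    where
    open ≤-Reasoning
    F : ℕ
    F = ∑[ y < n ] χ (lt k y ∧ E i y)
    split : ∀ y → T (lt i y ∧ E i y) → T (le (suc i) y ∧ lt y (suc k)) ⊎ T (lt k y ∧ E i y)
    split y iy with i<y , Eiy ← ∧-elim (lt i y) iy | y ≤? k
    ... | yes y≤k = inj₁ (∧-intro (le (suc i) y) i<y (fromWitness (s≤s y≤k)))
    ... | no  y≰k = inj₂ (∧-intro (lt k y) (fromWitness (≰⇒> y≰k)) Eiy)

  -- Rows i and k of R can only disagree as 1 in row i and 0 in row k in the
  -- columns k + rowOnes k < y ≤ i + rowOnes i.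
  R-colViolations : ∀ i k → ∑[ y < n ] colTerm R i k y ≤ (i + rowOnes i) ∸ (k + rowOnes k)
  R-colViolations i k = begin
    ∑[ y < n ] colTerm R i k y
      ≤⟨ ∑-mono-≤ n (λ y _ → ≤-trans (violation≤χ _ (R i y) (R k y)) (χ-mono _ _ (between y))) ⟩
    ∑[ y < n ] χ (le (suc (k + rowOnes k)) y ∧ lt y (suc (i + rowOnes i)))
      ≡⟨ ∑-interval n (suc (k + rowOnes k)) (suc (i + rowOnes i)) ⟩
    (n ⊓ suc (i + rowOnes i)) ∸ suc (k + rowOnes k)
      ≤⟨ ∸-monoˡ-≤ (suc (k + rowOnes k)) (m⊓n≤n n _) ⟩
    (i + rowOnes i) ∸ (k + rowOnes k)  ∎
    where
    open ≤-Reasoning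
    between : ∀ y → T (R i y ∧ not (R k y)) → T (le (suc (k + rowOnes k)) y ∧ lt y (suc (i + rowOnes i)))
    between y iy with Riy , ¬Rky ← ∧-elim (R i y) iy =
      ∧-intro (le (suc (k + rowOnes k)) y) (fromWitness (≰⇒> (toWitnessFalse ¬Rky))) (fromWitness (s≤s (toWitness Riy)))

  -- Since row i has at most k ∸ i ones before column k, the shift of R between
  -- rows i < k is bounded by the column violations of E between those rows.
  E-colViolations : ∀ {i k} → i < k → (i + rowOnes i) ∸ (k + rowOnes k) ≤ ∑[ y < n ] colTerm E i k y
  E-colViolations {i} {k} i<k = begin
    (i + rowOnes i) ∸ (k + rowOnes k)    ≤⟨ ∸-monoˡ-≤ (k + rowOnes k) (+-monoʳ-≤ i (rowOnes-beyond i k)) ⟩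
    (i + ((k ∸ i) + F)) ∸ (k + rowOnes k)
      ≡⟨ cong (_∸ (k + rowOnes k)) (trans (≡-sym (+-assoc i (k ∸ i) F)) (cong (_+ F) (m+[n∸m]≡n (<⇒≤ i<k)))) ⟩
    (k + F) ∸ (k + rowOnes k)            ≡⟨ [m+n]∸[m+o]≡n∸o k F (rowOnes k) ⟩
    F ∸ rowOnes k                        ≤⟨ ∑-∸ n _ _ ⟩
    ∑[ y < n ] (χ (lt k y ∧ E i y) ∸ χ (lt k y ∧ E k y))
      ≡⟨ ∑-cong n (λ y _ → ≡-sym (violation-window (lt k y) (E i y) (E k y) (fromWitness i<k))) ⟩
    ∑[ y < n ] colTerm E i k y           ∎
    where
    open ≤-Reasoning
    F : ℕ
    F = ∑[ y < n ] χ (lt k y ∧ E i y)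

  row-sorting-colViolations : ∑ n (colViolations n R) ≤ ∑ n (colViolations n E)
  row-sorting-colViolations = begin
    ∑ n (colViolations n R)                      ≡⟨ ∑-rotate n (colTerm R) ⟩
    ∑[ i < n ] ∑[ k < n ] ∑[ y < n ] colTerm R i k y
      ≤⟨ ∑-mono-≤ n (λ i _ → ∑-mono-≤ n λ k _ → rows i k) ⟩
    ∑[ i < n ] ∑[ k < n ] ∑[ y < n ] colTerm E i k y  ≡⟨ ≡-sym (∑-rotate n (colTerm E)) ⟩
    ∑ n (colViolations n E)                      ∎
    where
    open ≤-Reasoning
    rows : ∀ i k → ∑[ y < n ] colTerm R i k y ≤ ∑[ y < n ] colTerm E i k y
    rows i k = cases (i <? k)
      where
      cases : Dec (i < k) → ∑[ y < n ] colTerm R i k y ≤ ∑[ y < n ] colTerm E i k y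
      cases (yes i<k) = ≤-trans (R-colViolations i k) (E-colViolations i<k)
      cases (no  i≮k) = ∑-mono-≤ n (λ y _ →
        ≤-trans (≤-reflexive (violation-outside (lt k y) (R i y) (R k y) (fromWitnessFalse i≮k))) z≤n)

  -- Moving the column one step right adds at most the single new row y.
  colOnes-step : ∀ y → colOnes (suc y) ≤ suc (colOnes y)
  colOnes-step y = begin
    colOnes (suc y)
      ≤⟨ ∑-mono-≤ n (λ x _ → χ-cover _ _ _ (split x)) ⟩
    ∑[ x < n ] (χ (lt x y ∧ R x y) + χ (le y x ∧ lt x (suc y)))
      ≡⟨ ∑-distrib-+ n _ _ ⟩
    colOnes y + ∑[ x < n ] χ (le y x ∧ lt x (suc y))
      ≡⟨ cong (colOnes y +_) (∑-interval n y (suc y)) ⟩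
    colOnes y + ((n ⊓ suc y) ∸ y)
      ≤⟨ +-monoʳ-≤ (colOnes y) (≤-trans (∸-monoˡ-≤ y (m⊓n≤n n (suc y))) (≤-reflexive (m+n∸n≡m 1 y))) ⟩
    colOnes y + 1
      ≡⟨ +-comm (colOnes y) 1 ⟩
    suc (colOnes y)  ∎
    where
    open ≤-Reasoning
    split : ∀ x → T (lt x (suc y) ∧ R x (suc y)) → T (lt x y ∧ R x y) ⊎ T (le y x ∧ lt x (suc y))
    split x xy with x<sy , Rxsy ← ∧-elim (lt x (suc y)) xy = cases (x <? y)
      where
      cases : Dec (x < y) → T (lt x y ∧ R x y) ⊎ T (le y x ∧ lt x (suc y))
      cases (yes x<y) = inj₁ (∧-intro (lt x y) (fromWitness x<y) (fromWitness (≤-trans (n≤1+n y) (toWitness Rxsy))))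
      cases (no  x≮y) = inj₂ (∧-intro (le y x) (fromWitness (≮⇒≥ x≮y)) x<sy)

  colOnes-lipschitz : ∀ y d → colOnes (y + d) ≤ colOnes y + d
  colOnes-lipschitz y zero    = ≤-reflexive (trans (cong colOnes (+-identityʳ y)) (≡-sym (+-identityʳ (colOnes y))))
  colOnes-lipschitz y (suc d) = begin
    colOnes (y + suc d)    ≡⟨ cong colOnes (+-suc y d) ⟩
    colOnes (suc (y + d))  ≤⟨ colOnes-step (y + d) ⟩
    suc (colOnes (y + d))  ≤⟨ s≤s (colOnes-lipschitz y d) ⟩
    suc (colOnes y + d)    ≡⟨ ≡-sym (+-suc (colOnes y) d) ⟩
    colOnes y + suc d      ∎
    where open ≤-Reasoning

  -- The ones of C spread away from the diagonal monotonically: leftwards in a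
  -- row (thanks to the Lipschitz bound on colOnes) and downwards in a column.
  C-leftward : ∀ x {y z} → y < z → T (C x z) → T (C x y)
  C-leftward x {y} {z} y<z Cxz = fromWitness (+-cancelʳ-≤ (z ∸ y) y (x + colOnes y) (begin
    y + (z ∸ y)                ≡⟨ m+[n∸m]≡n (<⇒≤ y<z) ⟩
    z                          ≤⟨ toWitness Cxz ⟩
    x + colOnes z              ≤⟨ +-monoʳ-≤ x (subst (λ t → colOnes t ≤ colOnes y + (z ∸ y))
                                    (m+[n∸m]≡n (<⇒≤ y<z)) (colOnes-lipschitz y (z ∸ y))) ⟩
    x + (colOnes y + (z ∸ y))  ≡⟨ ≡-sym (+-assoc x (colOnes y) (z ∸ y)) ⟩
    x + colOnes y + (z ∸ y)    ∎))
    where open ≤-Reasoning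

  C-downward : ∀ {x y} z → x < y → T (C x z) → T (C y z)
  C-downward z x<y Cxz = fromWitness (≤-trans (toWitness Cxz) (+-monoˡ-≤ (colOnes z) (<⇒≤ x<y)))

  distance-bound : upperDistance n E C ^ 3 ≤ 8 * robinsonDefect n E * n ^ 3
  distance-bound = begin
    upperDistance n E C ^ 3
      ≤⟨ cube-bound n (∑ n rowCost) (∑ n colCost) (∑ n (rowViolations n E)) (∑ n (colViolations n E))
           (upperDistance-triangle n E R C) rows cols (upperDistance≤n² n E C) ⟩
    8 * (∑ n (rowViolations n E) + ∑ n (colViolations n E)) * n ^ 3
      ≡⟨ cong (λ d → 8 * d * n ^ 3) (≡-sym (defect-split n E)) ⟩
    8 * robinsonDefect n E * n ^ 3  ∎
    where
    open ≤-Reasoning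
    rowCost colCost : ℕ → ℕ
    rowCost x = mismatch n (lt x) (E x) (R x)
    colCost y = mismatch n (λ x → lt x y) (λ x → R x y) (λ x → C x y)
    rows : ∑ n rowCost * ∑ n rowCost ≤ n * (4 * ∑ n (rowViolations n E))
    rows = ∑-square-bound n rowCost (rowViolations n E) (λ x → row-sorting-cost)
    cols : ∑ n colCost * ∑ n colCost ≤ n * (4 * ∑ n (colViolations n E))
    cols = ≤-trans (∑-square-bound n colCost (colViolations n R) (λ y y<n → col-sorting-cost (<⇒≤ y<n)))
                   (*-monoʳ-≤ n (*-monoʳ-≤ 4 row-sorting-colViolations))

∑-suc : ∀ n (f : ℕ → ℕ) → ∑ (suc n) f ≡ f 0 + ∑[ x < n ] f (suc x)
∑-suc zero    f = +-comm 0 (f 0)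
∑-suc (suc n) f = trans (cong (_+ f (suc n)) (∑-suc n f)) (+-assoc (f 0) _ _)

Σ≡∑ : ∀ n (h : Fin n → ℕ) (g : ℕ → ℕ) → (∀ i → h i ≡ g (toℕ i)) → Σ[ n ] h ≡ ∑ n g
Σ≡∑ zero    h g _  = refl
Σ≡∑ (suc n) h g eq = begin
  Σ[ suc n ] h                   ≡⟨ cong (λ xs → h Fin.zero + sum xs)
                                      (trans (map-tabulate Fin.suc h) (≡-sym (map-tabulate id (h ∘ Fin.suc)))) ⟩
  h Fin.zero + Σ[ n ] (h ∘ Fin.suc)  ≡⟨ cong₂ _+_ (eq Fin.zero) (Σ≡∑ n (h ∘ Fin.suc) (g ∘ suc) (eq ∘ Fin.suc)) ⟩
  g 0 + ∑[ x < n ] g (suc x)     ≡⟨ ≡-sym (∑-suc n g) ⟩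
  ∑ (suc n) g                    ∎
  where open ≡-Reasoning

extend : ∀ {n} → (Fin n → Fin n → Bool) → ℕ → ℕ → Bool
extend {n} f x y with x <? n | y <? n
... | yes x<n | yes y<n = f (fromℕ< x<n) (fromℕ< y<n)
... | _       | _       = false

extend-toℕ : ∀ {n} (f : Fin n → Fin n → Bool) i j → extend f (toℕ i) (toℕ j) ≡ f i j
extend-toℕ {n} f i j with toℕ i <? n | toℕ j <? n
... | yes i<n | yes j<n = cong₂ f (fromℕ<-toℕ i i<n) (fromℕ<-toℕ j j<n)
... | no  i≮n | _       = ⊥-elim (i≮n (toℕ<n i))
... | yes _   | no  j≮n = ⊥-elim (j≮n (toℕ<n j))

symmetrise : (ℕ → ℕ → Bool) → ℕ → ℕ → Bool
symmetrise U x y = if lt x y then U x y else if lt y x then U y x else false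

symmetrise-sym : ∀ U x y → symmetrise U x y ≡ symmetrise U y x
symmetrise-sym U x y = swap (lt x y) (lt y x) (λ xy yx → <-asym (toWitness xy) (toWitness yx))
  where
  swap : ∀ a b {u v} → (T a → T b → ⊥) → (if a then u else if b then v else false) ≡ (if b then v else if a then u else false)
  swap true  true  ¬both = ⊥-elim (¬both tt tt)
  swap true  false _     = refl
  swap false true  _     = refl
  swap false false _     = refl

symmetrise-irrefl : ∀ U x → symmetrise U x x ≡ false
symmetrise-irrefl U x = neither (lt x x) (fromWitnessFalse (<-irrefl refl))
  where
  neither : ∀ a {u} → T (not a) → (if a then u else if a then u else false) ≡ false
  neither false _ = refl

symmetrise-upper : ∀ U {x y} → x < y → symmetrise U x y ≡ U x y
symmetrise-upper U {x} {y} x<y = above (lt x y) (fromWitness x<y)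
  where
  above : ∀ a {u v} → T a → (if a then u else v) ≡ u
  above true _ = refl

upperGraph : ∀ n → (ℕ → ℕ → Bool) → Graph n
upperGraph n U = record
  { adj    = λ i j → symmetrise U (toℕ i) (toℕ j)
  ; sym    = λ i j → symmetrise-sym U (toℕ i) (toℕ j)
  ; irrefl = λ i → symmetrise-irrefl U (toℕ i)
  }

B-upper : ∀ {n} (H : Graph n) (i j : Fin n) → toℕ i < toℕ j → B H i j ≡ χ (adj H i j)
B-upper H i j i<j with i Fin.≟ j
... | yes refl = ⊥-elim (<-irrefl refl i<j)
... | no  _    = refl

if-cong : ∀ c {p q} → (T c → p ≡ q) → (if c then p else 0) ≡ (if c then q else 0)
if-cong true  eq = eq tt
if-cong false _  = refl

ed-upperGraph : ∀ {n} (G : Graph n) U → ed G (upperGraph n U) ≡ upperDistance n (extend (adj G)) U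
ed-upperGraph {n} G U = Σ≡∑ n _ _ λ i → Σ≡∑ n _ _ λ j → if-cong (lt (toℕ i) (toℕ j)) λ i<j →
  cong χ (cong₂ _xor_ (≡-sym (extend-toℕ (adj G) i j)) (symmetrise-upper U (toWitness i<j)))

-- Only entries above the diagonal enter Γ₁, where B G is the adjacency matrix.
Γ₁-extend : ∀ {n} (G : Graph n) → Γ₁Gnum G ≡ robinsonDefect n (extend (adj G))
Γ₁-extend {n} G = Σ≡∑ n _ _ λ i → Σ≡∑ n _ _ λ k → Σ≡∑ n _ _ λ j →
  if-cong (lt (toℕ i) (toℕ k) ∧ lt (toℕ k) (toℕ j)) λ ikj →
    let i<k = toWitness (proj₁ (∧-elim (lt (toℕ i) (toℕ k)) ikj))
        k<j = toWitness (proj₂ (∧-elim (lt (toℕ i) (toℕ k)) ikj))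
        i<j = <-trans i<k k<j
    in cong₂ _+_ (cong₂ _∸_ (entry i j i<j) (entry i k i<k)) (cong₂ _∸_ (entry i j i<j) (entry k j k<j))
  where
  entry : ∀ a b → toℕ a < toℕ b → B G a b ≡ χ (extend (adj G) (toℕ a) (toℕ b))
  entry a b a<b = trans (B-upper G a b a<b) (cong χ (≡-sym (extend-toℕ (adj G) a b)))

upperGraph-unitInterval : ∀ n (U : ℕ → ℕ → Bool) →
  (∀ x {y z} → y < z → T (U x z) → T (U x y)) →
  (∀ {x y} z → x < y → T (U x z) → T (U y z)) →
  IsUnitInterval (upperGraph n U)
upperGraph-unitInterval n U leftward downward = Permutation.id , robinson
  where
  H : Graph n
  H = upperGraph n U
  entry : ∀ a b → toℕ a < toℕ b → B H a b ≡ χ (U (toℕ a) (toℕ b))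
  entry a b a<b = trans (B-upper H a b a<b) (cong χ (symmetrise-upper U a<b))
  robinson : IsRobinson (λ p q → B H (Permutation.id Permutation.⟨$⟩ʳ p) (Permutation.id Permutation.⟨$⟩ʳ q))
  robinson i j k i<j j<k =
      subst₂ _≤_ (≡-sym (entry i k i<k)) (≡-sym (entry i j i<j)) (χ-mono _ _ (leftward (toℕ i) j<k))
    , subst₂ _≤_ (≡-sym (entry i k i<k)) (≡-sym (entry j k j<k)) (χ-mono _ _ (downward (toℕ k) i<j))
    where
    i<k : toℕ i < toℕ k
    i<k = <-trans i<j j<k

corollary2p4 : (n : ℕ) (G : Graph n) →
    Σ (Graph n) λ Ĝ → IsUnitInterval Ĝ × (ed G Ĝ ^ 3 ≤ 26 ^ 3 * Γ₁Gnum G * n ^ 3)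
corollary2p4 n G = upperGraph n C , upperGraph-unitInterval n C C-leftward C-downward , (begin
  ed G (upperGraph n C) ^ 3        ≡⟨ cong (_^ 3) (ed-upperGraph G C) ⟩
  upperDistance n E C ^ 3          ≤⟨ distance-bound ⟩
  8 * robinsonDefect n E * n ^ 3   ≤⟨ *-monoˡ-≤ (n ^ 3) (*-monoˡ-≤ (robinsonDefect n E) 8≤26³) ⟩
  26 ^ 3 * robinsonDefect n E * n ^ 3  ≡⟨ cong (λ d → 26 ^ 3 * d * n ^ 3) (≡-sym (Γ₁-extend G)) ⟩
  26 ^ 3 * Γ₁Gnum G * n ^ 3        ∎)
  where
  open ≤-Reasoning
  E : ℕ → ℕ → Bool
  E = extend (adj G)
  open TwoStepSort n E
  8≤26³ : 8 ≤ 26 ^ 3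
  8≤26³ = m≤m+n 8 17568
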